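{- Let $h(k)=k$ for all $k\ge1$. Let $n$ and $m$ be positive integers and let $\mu$ be a partition of $m$. Then $$\mathcal{H}(\mu,n)=\prod_{k=0}^{|\mu|+\ell(\mu)-1}(n-k)\sum_{\lambda\in\mathrm{Orb}(\mu)}\prod_{k=1}^{\ell(\lambda)}\Big(k+\sum_{i=1}^k\lambda_i\Big)^{ -1}.$$
   Context: With $h(k)=k$, $h(0):=0$, $h_r(n):=\prod_{k=0}^{r-1}h(n-k)$. A composition is a finite sequence of positive integers $\mu=(\mu_1,\dots,\mu_r)$ with $\ell(\mu)=r$, $|\mu|=\sum\mu_i$; $\varepsilon$ is the empty composition. A partition is a non-increasing composition. $H(\mu,n)$ is defined by induction on length: $H(\varepsilon,n):=1$; for $\mu=(\mu_1,\dots,\mu_{r+1})$ and $n\ge|\mu|+\ell(\mu)$, $H(\mu,n):=\sum_{k=|\mu|+\ell(\mu)-1}^{n-1}h_{\mu_{r+1}}(k)H((\mu_1,\dots,\mu_r),k-\mu_{r+1})$; $H(\mu,n):=0$ if $n<|\mu|+\ell(\mu)$. $\mathrm{Orb}(\mu)$ is the set of distinct compositions obtained by permuting the parts of $\mu$, and $\mathcal{H}(\mu,n):=\sum_{\lambda\in\mathrm{Orb}(\mu)}H(\lambda,n)$. -}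

module Defs where

open import Data.Nat as ℕ using (ℕ; zero; suc; _+_; _*_; _∸_; _≥_; _<_)
open import Data.List using (List; []; _∷_; map; upTo; length; reverse; foldr)
open import Data.Nat.ListAction using (sum; product)
open import Data.List.Relation.Unary.AllPairs using (AllPairs)
open import Data.List.Relation.Unary.All using (All)
open import Data.Integer as ℤ using (ℤ; +_)
open import Data.Rational as ℚ using (ℚ)
open import Relation.Binary.PropositionalEquality using (_≡_)

sumRange : ℕ → ℕ → (ℕ → ℕ) → ℕ
sumRange lo hi f = sum (map (λ i → f (lo + i)) (upTo (hi ∸ lo)))

h : ℕ → ℕ
h k = k

-- h_r(n) = ∏_{k=0}^{r-1} h(n-k)   (only used with n ≥ r-1, so ∸ is exact)
hr : ℕ → ℕ → ℕ
hr r n = product (map (λ k → h (n ∸ k)) (upTo r))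

size : List ℕ → ℕ
size = sum

-- Hrev applied to the reversed composition: the head is the LAST part μ_{r+1}.
-- H(μ,n) = Σ_{k=|μ|+ℓ(μ)-1}^{n-1} h_{μ_{r+1}}(k) H((μ_1..μ_r), k-μ_{r+1}),
-- which is automatically 0 when n < |μ|+ℓ(μ) (empty range).
Hrev : List ℕ → ℕ → ℕ
Hrev [] n = 1
Hrev (a ∷ rest) n =
  sumRange (size (a ∷ rest) + length (a ∷ rest) ∸ 1) n
           (λ k → hr a k * Hrev rest (k ∸ a))

H : List ℕ → ℕ → ℕ
H μ n = Hrev (reverse μ) n

-- 𝓗 over a given (duplicate-free) enumeration O of Orb(μ)
calH : List (List ℕ) → ℕ → ℕ
calH O n = sum (map (λ λ' → H λ' n) O)

IsPartition : List ℕ → ℕ → Set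
IsPartition μ m = All (λ x → x ≥ 1) μ × AllPairs (λ x y → x ≥ y) μ × size μ ≡ m
  where open import Data.Product using (_×_)

invProdGo : ℕ → ℕ → List ℕ → ℚ
invProdGo j s [] = ℚ.1ℚ
invProdGo j s (x ∷ xs) = ((+ 1) ℚ./ suc (j + (s + x))) ℚ.* invProdGo (suc j) (s + x) xs

invProd : List ℕ → ℚ
invProd λ' = invProdGo 0 0 λ'

fallingℤ : ℕ → ℕ → ℤ
fallingℤ n N = foldr ℤ._*_ (+ 1) (map (λ k → (+ n) ℤ.- (+ k)) (upTo N))

{-# OPTIONS --safe #-}
module Submission where

-- With D(λ) = ∏_{k=1}^{ℓ(λ)} (k + λ₁ + ⋯ + λ_k), every composition satisfies
-- H(λ,n) · D(λ) = n(n-1)⋯(n-|λ|-ℓ(λ)+1). Induct on ℓ(λ): removing the last part a divides D(λ)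
-- by N+1 = |λ|+ℓ(λ), the summand h_a(k) H(λ',k-a) of the recursion times D(λ') becomes the
-- falling factorial k^(N), and the hockey-stick identity Σ_{k=N}^{n-1} (N+1) k^(N) = n^(N+1)
-- closes the induction. Since |λ|+ℓ(λ) is constant on Orb(μ), dividing by D(λ) and summing over
-- the orbit gives the theorem.

open import Defs
open import Data.Nat using (ℕ; _<_)
open import Data.List using (List; map; length; foldr)
open import Data.Integer using (+_)
open import Data.List.Relation.Unary.Unique.Propositional using (Unique)
open import Data.List.Membership.Propositional using (_∈_)
open import Data.List.Relation.Binary.Permutation.Propositional using (_↭_)
open import Function.Bundles using (_⇔_)
open import Relation.Binary.PropositionalEquality using (_≡_)
open import Data.Rational using (ℚ; 0ℚ)
open import Data.Rational as Q using ()

open import Data.Nat using (zero; suc; _+_; _*_; _∸_; _≤_; z≤n; s≤s; _≤?_)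
open import Data.Nat.Properties
open import Data.Nat.Combinatorics.Base using (_P′_)
open import Data.Nat.Combinatorics.Specification using (nP′k≡n[n∸1P′k∸1]; P′-rec)
open import Data.Nat.ListAction using (sum; product)
open import Data.Nat.ListAction.Properties using (sum-++; sum-↭)
open import Data.Nat.Tactic.RingSolver using (solve-∀)
open import Data.List using ([]; _∷_; _∷ʳ_; reverse; upTo; applyUpTo)
open import Data.List.Properties
  using (map-upTo; upTo-∷ʳ; map-++; map-cong; unfold-reverse; length-reverse; reverse-involutive)
open import Data.List.Relation.Unary.All as All using (All; []; _∷_)
open import Data.List.Relation.Binary.Permutation.Propositional.Properties using (↭-reverse; ↭-length)
import Data.Integer as ℤ
import Data.Integer.Properties as ℤ
import Data.Rational.Properties as Q
import Data.Rational.Unnormalised as ℚᵘ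
import Data.Rational.Unnormalised.Properties as ℚᵘ
open import Function.Bundles using (module Equivalence)
open import Relation.Nullary using (yes; no)
open import Relation.Binary.PropositionalEquality using (refl; sym; trans; cong; cong₂; module ≡-Reasoning)
open import Algebra.Bundles using (CommutativeMonoid)
open import Algebra.Properties.CommutativeSemigroup *-commutativeSemigroup using (x∙yz≈y∙xz; x∙yz≈xz∙y)

fromℕ : ℕ → ℚ
fromℕ a = + a Q./ 1

toℚᵘ-fromℕ : ∀ a → Q.toℚᵘ (fromℕ a) ℚᵘ.≃ ℚᵘ.mkℚᵘ (+ a) 0
toℚᵘ-fromℕ a = Q.toℚᵘ-fromℚᵘ (ℚᵘ.mkℚᵘ (+ a) 0)

fromℕ-+ : ∀ a b → fromℕ (a + b) ≡ fromℕ a Q.+ fromℕ b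
fromℕ-+ a b = Q.toℚᵘ-injective (begin
    Q.toℚᵘ (fromℕ (a + b))
  ≈⟨ toℚᵘ-fromℕ (a + b) ⟩
    ℚᵘ.mkℚᵘ (+ (a + b)) 0
  ≈⟨ ℚᵘ.*≡* (cong (ℤ._* + 1) (trans (ℤ.pos-+ a b) (sym (cong₂ ℤ._+_ (ℤ.*-identityʳ (+ a)) (ℤ.*-identityʳ (+ b)))))) ⟩
    ℚᵘ.mkℚᵘ (+ a) 0 ℚᵘ.+ ℚᵘ.mkℚᵘ (+ b) 0
  ≈⟨ ℚᵘ.≃-sym (ℚᵘ.+-cong (toℚᵘ-fromℕ a) (toℚᵘ-fromℕ b)) ⟩
    Q.toℚᵘ (fromℕ a) ℚᵘ.+ Q.toℚᵘ (fromℕ b)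
  ≈⟨ ℚᵘ.≃-sym (Q.toℚᵘ-homo-+ (fromℕ a) (fromℕ b)) ⟩
    Q.toℚᵘ (fromℕ a Q.+ fromℕ b) ∎)
  where open ℚᵘ.≃-Reasoning

fromℕ-* : ∀ a b → fromℕ (a * b) ≡ fromℕ a Q.* fromℕ b
fromℕ-* a b = Q.toℚᵘ-injective (begin
    Q.toℚᵘ (fromℕ (a * b))
  ≈⟨ toℚᵘ-fromℕ (a * b) ⟩
    ℚᵘ.mkℚᵘ (+ (a * b)) 0
  ≡⟨ cong (λ z → ℚᵘ.mkℚᵘ z 0) (ℤ.pos-* a b) ⟩
    ℚᵘ.mkℚᵘ (+ a) 0 ℚᵘ.* ℚᵘ.mkℚᵘ (+ b) 0
  ≈⟨ ℚᵘ.≃-sym (ℚᵘ.*-cong (toℚᵘ-fromℕ a) (toℚᵘ-fromℕ b)) ⟩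
    Q.toℚᵘ (fromℕ a) ℚᵘ.* Q.toℚᵘ (fromℕ b)
  ≈⟨ ℚᵘ.≃-sym (Q.toℚᵘ-homo-* (fromℕ a) (fromℕ b)) ⟩
    Q.toℚᵘ (fromℕ a Q.* fromℕ b) ∎)
  where open ℚᵘ.≃-Reasoning

1/[1+d]*[1+d]≡1 : ∀ d → (+ 1 Q./ suc d) Q.* fromℕ (suc d) ≡ Q.1ℚ
1/[1+d]*[1+d]≡1 d = Q.toℚᵘ-injective (begin
    Q.toℚᵘ ((+ 1 Q./ suc d) Q.* fromℕ (suc d))
  ≈⟨ Q.toℚᵘ-homo-* (+ 1 Q./ suc d) (fromℕ (suc d)) ⟩
    Q.toℚᵘ (+ 1 Q./ suc d) ℚᵘ.* Q.toℚᵘ (fromℕ (suc d))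
  ≈⟨ ℚᵘ.*-cong (Q.toℚᵘ-fromℚᵘ (ℚᵘ.mkℚᵘ (+ 1) d)) (toℚᵘ-fromℕ (suc d)) ⟩
    ℚᵘ.mkℚᵘ (+ 1) d ℚᵘ.* ℚᵘ.mkℚᵘ (+ suc d) 0
  ≈⟨ ℚᵘ.*≡* (trans (ℤ.*-identityʳ _) (trans (ℤ.*-identityˡ (+ suc d))
       (sym (trans (ℤ.*-identityˡ _) (cong +_ (*-identityʳ (suc d))))))) ⟩
    Q.toℚᵘ Q.1ℚ ∎)
  where open ℚᵘ.≃-Reasoning

open ≡-Reasoning

nP′[1+k]≡0 : ∀ {n k} → n ≤ k → n P′ suc k ≡ 0
nP′[1+k]≡0 {n} {k} n≤k = cong (_* (n P′ k)) (m≤n⇒m∸n≡0 n≤k)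

P′-+ : ∀ k a m → k P′ (a + m) ≡ (k P′ a) * ((k ∸ a) P′ m)
P′-+ k a zero = trans (cong (k P′_) (+-identityʳ a)) (sym (*-identityʳ (k P′ a)))
P′-+ k a (suc m) = begin
    k P′ (a + suc m)
  ≡⟨ cong (k P′_) (+-suc a m) ⟩
    (k ∸ (a + m)) * (k P′ (a + m))
  ≡⟨ cong₂ _*_ (sym (∸-+-assoc k a m)) (P′-+ k a m) ⟩
    (k ∸ a ∸ m) * ((k P′ a) * ((k ∸ a) P′ m))
  ≡⟨ x∙yz≈y∙xz (k ∸ a ∸ m) (k P′ a) _ ⟩
    (k P′ a) * ((k ∸ a) P′ suc m) ∎

product-applyUpTo-∸ : ∀ a k → product (applyUpTo (k ∸_) a) ≡ k P′ a
product-applyUpTo-∸ zero k = refl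
product-applyUpTo-∸ (suc a) zero = sym (nP′[1+k]≡0 {k = a} z≤n)
product-applyUpTo-∸ (suc a) (suc k) =
  trans (cong (suc k *_) (product-applyUpTo-∸ a k)) (sym (nP′k≡n[n∸1P′k∸1] (suc k) (suc a)))

hr≡P′ : ∀ a k → hr a k ≡ k P′ a
hr≡P′ a k = trans (cong product (map-upTo (k ∸_) a)) (product-applyUpTo-∸ a k)

fallingℤ≡P′ : ∀ n N → fallingℤ n N ≡ + (n P′ N)
fallingℤ≡P′ n N = trans (cong (foldr ℤ._*_ (+ 1)) (map-upTo (λ k → + n ℤ.- + k) N)) (go n N)
  where
  shift : ∀ n N → applyUpTo (λ k → + suc n ℤ.- + suc k) N ≡ applyUpTo (λ k → + n ℤ.- + k) N
  shift n N = begin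
      applyUpTo (λ k → + suc n ℤ.- + suc k) N
    ≡⟨ sym (map-upTo _ N) ⟩
      map (λ k → + suc n ℤ.- + suc k) (upTo N)
    ≡⟨ map-cong (λ k → trans (ℤ.[1+m]⊖[1+n]≡m⊖n n k) (sym (ℤ.m-n≡m⊖n n k))) (upTo N) ⟩
      map (λ k → + n ℤ.- + k) (upTo N)
    ≡⟨ map-upTo _ N ⟩
      applyUpTo (λ k → + n ℤ.- + k) N ∎
  go : ∀ n N → foldr ℤ._*_ (+ 1) (applyUpTo (λ k → + n ℤ.- + k) N) ≡ + (n P′ N)
  go n zero = refl
  go zero (suc N) = cong +_ (sym (nP′[1+k]≡0 {k = N} z≤n))
  go (suc n) (suc N) = begin
      (+ suc n ℤ.- + 0) ℤ.* foldr ℤ._*_ (+ 1) (applyUpTo (λ k → + suc n ℤ.- + suc k) N)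
    ≡⟨ cong₂ ℤ._*_ (ℤ.+-identityʳ (+ suc n)) (cong (foldr ℤ._*_ (+ 1)) (shift n N)) ⟩
      + suc n ℤ.* foldr ℤ._*_ (+ 1) (applyUpTo (λ k → + n ℤ.- + k) N)
    ≡⟨ cong (+ suc n ℤ.*_) (go n N) ⟩
      + suc n ℤ.* + (n P′ N)
    ≡⟨ sym (ℤ.pos-* (suc n) (n P′ N)) ⟩
      + (suc n * (n P′ N))
    ≡⟨ cong +_ (sym (nP′k≡n[n∸1P′k∸1] (suc n) (suc N))) ⟩
      + (suc n P′ suc N) ∎

sum-map-*ʳ : ∀ {A : Set} (f : A → ℕ) c xs → sum (map f xs) * c ≡ sum (map (λ x → f x * c) xs)
sum-map-*ʳ f c [] = refl
sum-map-*ʳ f c (x ∷ xs) = trans (*-distribʳ-+ c (f x) _) (cong (_+_ (f x * c)) (sum-map-*ʳ f c xs))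

sumRange-*ʳ : ∀ lo hi f c → sumRange lo hi f * c ≡ sumRange lo hi (λ k → f k * c)
sumRange-*ʳ lo hi f c = sum-map-*ʳ (λ i → f (lo + i)) c (upTo (hi ∸ lo))

sumRange-cong : ∀ lo hi {f g : ℕ → ℕ} → (∀ k → f k ≡ g k) → sumRange lo hi f ≡ sumRange lo hi g
sumRange-cong lo hi f≗g = cong sum (map-cong (λ i → f≗g (lo + i)) (upTo (hi ∸ lo)))

sumRange-empty : ∀ {lo hi} (f : ℕ → ℕ) → hi ≤ lo → sumRange lo hi f ≡ 0
sumRange-empty {lo} f hi≤lo = cong (λ m → sum (map (λ i → f (lo + i)) (upTo m))) (m≤n⇒m∸n≡0 hi≤lo)

sumRange-suc : ∀ {lo hi} (f : ℕ → ℕ) → lo ≤ hi → sumRange lo (suc hi) f ≡ sumRange lo hi f + f hi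
sumRange-suc {lo} {hi} f lo≤hi = begin
    sum (map g (upTo (suc hi ∸ lo)))
  ≡⟨ cong (λ m → sum (map g (upTo m))) (+-∸-assoc 1 lo≤hi) ⟩
    sum (map g (upTo (suc (hi ∸ lo))))
  ≡⟨ cong (λ xs → sum (map g xs)) (sym (upTo-∷ʳ (hi ∸ lo))) ⟩
    sum (map g (upTo (hi ∸ lo) ∷ʳ (hi ∸ lo)))
  ≡⟨ cong sum (map-++ g (upTo (hi ∸ lo)) _) ⟩
    sum (map g (upTo (hi ∸ lo)) ∷ʳ g (hi ∸ lo))
  ≡⟨ sum-++ (map g (upTo (hi ∸ lo))) _ ⟩
    sumRange lo hi f + (g (hi ∸ lo) + 0)
  ≡⟨ cong (_+_ (sumRange lo hi f)) (trans (+-identityʳ _) (cong f (m+[n∸m]≡n lo≤hi))) ⟩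
    sumRange lo hi f + f hi ∎
  where
  g : ℕ → ℕ
  g i = f (lo + i)

hockeyStick : ∀ N n → sumRange N n (_P′ N) * suc N ≡ n P′ suc N
hockeyStick N zero =
  trans (cong (_* suc N) (sumRange-empty {lo = N} (_P′ N) z≤n)) (sym (nP′[1+k]≡0 {k = N} z≤n))
hockeyStick N (suc n) with N ≤? n
... | no N≰n =
  trans (cong (_* suc N) (sumRange-empty (_P′ N) (≰⇒> N≰n))) (sym (nP′[1+k]≡0 (≰⇒> N≰n)))
... | yes N≤n = begin
    sumRange N (suc n) (_P′ N) * suc N
  ≡⟨ cong (_* suc N) (sumRange-suc (_P′ N) N≤n) ⟩
    (sumRange N n (_P′ N) + (n P′ N)) * suc N
  ≡⟨ *-distribʳ-+ (suc N) (sumRange N n (_P′ N)) (n P′ N) ⟩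
    sumRange N n (_P′ N) * suc N + (n P′ N) * suc N
  ≡⟨ cong₂ _+_ (hockeyStick N n) (*-comm (n P′ N) (suc N)) ⟩
    n P′ suc N + suc N * (n P′ N)
  ≡⟨ +-comm (n P′ suc N) _ ⟩
    suc N * (n P′ N) + n P′ suc N
  ≡⟨ sym (P′-rec (s≤s N≤n)) ⟩
    suc n P′ suc N ∎

-- denominator λ is D(λ) = 1 / invProd λ; j and s are the accumulators of invProdGo.
denominatorFrom : ℕ → ℕ → List ℕ → ℕ
denominatorFrom j s [] = 1
denominatorFrom j s (x ∷ xs) = suc (j + (s + x)) * denominatorFrom (suc j) (s + x) xs

denominator : List ℕ → ℕ
denominator = denominatorFrom 0 0

denominatorFrom-∷ʳ : ∀ j s xs x →
  denominatorFrom j s (xs ∷ʳ x) ≡ denominatorFrom j s xs * suc (j + length xs + (s + size xs + x))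
denominatorFrom-∷ʳ j s [] x = singleton j s x
  where
  singleton : ∀ j s x → suc (j + (s + x)) * 1 ≡ 1 * suc (j + 0 + (s + 0 + x))
  singleton = solve-∀
denominatorFrom-∷ʳ j s (y ∷ xs) x = begin
    suc (j + (s + y)) * denominatorFrom (suc j) (s + y) (xs ∷ʳ x)
  ≡⟨ cong (suc (j + (s + y)) *_) (denominatorFrom-∷ʳ (suc j) (s + y) xs x) ⟩
    suc (j + (s + y)) * (denominatorFrom (suc j) (s + y) xs * suc (suc j + length xs + (s + y + size xs + x)))
  ≡⟨ sym (*-assoc (suc (j + (s + y))) (denominatorFrom (suc j) (s + y) xs) _) ⟩
    denominatorFrom j s (y ∷ xs) * suc (suc j + length xs + (s + y + size xs + x))
  ≡⟨ cong (λ t → denominatorFrom j s (y ∷ xs) * suc t) (rearrange j s y x (length xs) (size xs)) ⟩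
    denominatorFrom j s (y ∷ xs) * suc (j + length (y ∷ xs) + (s + size (y ∷ xs) + x)) ∎
  where
  rearrange : ∀ j s y x l t → suc j + l + (s + y + t + x) ≡ j + suc l + (s + (y + t) + x)
  rearrange = solve-∀

size-reverse : ∀ xs → size (reverse xs) ≡ size xs
size-reverse xs = sum-↭ (↭-reverse xs)

denominator-reverse-∷ : ∀ a r →
  denominator (reverse (a ∷ r)) ≡ suc (a + (size r + length r)) * denominator (reverse r)
denominator-reverse-∷ a r = begin
    denominator (reverse (a ∷ r))
  ≡⟨ cong denominator (unfold-reverse a r) ⟩
    denominator (reverse r ∷ʳ a)
  ≡⟨ denominatorFrom-∷ʳ 0 0 (reverse r) a ⟩
    denominator (reverse r) * suc (length (reverse r) + (size (reverse r) + a))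
  ≡⟨ cong₂ (λ l t → denominator (reverse r) * suc (l + (t + a))) (length-reverse r) (size-reverse r) ⟩
    denominator (reverse r) * suc (length r + (size r + a))
  ≡⟨ rearrange (denominator (reverse r)) a (size r) (length r) ⟩
    suc (a + (size r + length r)) * denominator (reverse r) ∎
  where
  rearrange : ∀ d a t l → d * suc (l + (t + a)) ≡ suc (a + (t + l)) * d
  rearrange = solve-∀

Hrev-*-denominator : ∀ r n → Hrev r n * denominator (reverse r) ≡ n P′ (size r + length r)
Hrev-*-denominator [] n = refl
Hrev-*-denominator (a ∷ r) n = begin
    sumRange lo n g * denominator (reverse (a ∷ r))
  ≡⟨ cong₂ (λ t d → sumRange t n g * d) lo≡N (denominator-reverse-∷ a r) ⟩
    sumRange N n g * (suc N * D)
  ≡⟨ x∙yz≈xz∙y (sumRange N n g) (suc N) D ⟩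
    sumRange N n g * D * suc N
  ≡⟨ cong (_* suc N) (trans (sumRange-*ʳ N n g D) (sumRange-cong N n summand)) ⟩
    sumRange N n (_P′ N) * suc N
  ≡⟨ hockeyStick N n ⟩
    n P′ suc N
  ≡⟨ cong (n P′_) (sym total) ⟩
    n P′ (size (a ∷ r) + length (a ∷ r)) ∎
  where
  N = a + (size r + length r)
  D = denominator (reverse r)
  lo = size (a ∷ r) + length (a ∷ r) ∸ 1
  g : ℕ → ℕ
  g k = hr a k * Hrev r (k ∸ a)
  total : size (a ∷ r) + length (a ∷ r) ≡ suc N
  total = trans (+-suc (a + size r) (length r)) (cong suc (+-assoc a (size r) (length r)))
  lo≡N : lo ≡ N
  lo≡N = cong (_∸ 1) total
  summand : ∀ k → g k * D ≡ k P′ N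
  summand k = begin
      hr a k * Hrev r (k ∸ a) * D
    ≡⟨ *-assoc (hr a k) (Hrev r (k ∸ a)) D ⟩
      hr a k * (Hrev r (k ∸ a) * D)
    ≡⟨ cong₂ _*_ (hr≡P′ a k) (Hrev-*-denominator r (k ∸ a)) ⟩
      (k P′ a) * ((k ∸ a) P′ (size r + length r))
    ≡⟨ sym (P′-+ k a (size r + length r)) ⟩
      k P′ N ∎

H-*-denominator : ∀ λ' n → H λ' n * denominator λ' ≡ n P′ (size λ' + length λ')
H-*-denominator λ' n = begin
    Hrev (reverse λ') n * denominator λ'
  ≡⟨ cong (λ xs → Hrev (reverse λ') n * denominator xs) (sym (reverse-involutive λ')) ⟩
    Hrev (reverse λ') n * denominator (reverse (reverse λ'))
  ≡⟨ Hrev-*-denominator (reverse λ') n ⟩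
    n P′ (size (reverse λ') + length (reverse λ'))
  ≡⟨ cong₂ (λ t l → n P′ (t + l)) (size-reverse λ') (length-reverse λ') ⟩
    n P′ (size λ' + length λ') ∎

invProdGo-*-denominatorFrom : ∀ j s xs → invProdGo j s xs Q.* fromℕ (denominatorFrom j s xs) ≡ Q.1ℚ
invProdGo-*-denominatorFrom j s [] = Q.*-identityˡ Q.1ℚ
invProdGo-*-denominatorFrom j s (x ∷ xs) = begin
    (c Q.* rest) Q.* fromℕ (suc m * d)
  ≡⟨ cong ((c Q.* rest) Q.*_) (fromℕ-* (suc m) d) ⟩
    (c Q.* rest) Q.* (fromℕ (suc m) Q.* fromℕ d)
  ≡⟨ interchange c rest (fromℕ (suc m)) (fromℕ d) ⟩
    (c Q.* fromℕ (suc m)) Q.* (rest Q.* fromℕ d)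
  ≡⟨ cong₂ Q._*_ (1/[1+d]*[1+d]≡1 m) (invProdGo-*-denominatorFrom (suc j) (s + x) xs) ⟩
    Q.1ℚ Q.* Q.1ℚ
  ≡⟨ Q.*-identityˡ Q.1ℚ ⟩
    Q.1ℚ ∎
  where
  open import Algebra.Properties.CommutativeSemigroup
    (CommutativeMonoid.commutativeSemigroup Q.*-1-commutativeMonoid) using (interchange)
  m = j + (s + x)
  c = + 1 Q./ suc m
  rest = invProdGo (suc j) (s + x) xs
  d = denominatorFrom (suc j) (s + x) xs

fromℕ-H : ∀ λ' n → fromℕ (H λ' n) ≡ fromℕ (n P′ (size λ' + length λ')) Q.* invProd λ'
fromℕ-H λ' n = begin
    fromℕ (H λ' n)
  ≡⟨ sym (Q.*-identityʳ (fromℕ (H λ' n))) ⟩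
    fromℕ (H λ' n) Q.* Q.1ℚ
  ≡⟨ cong (fromℕ (H λ' n) Q.*_) (sym (trans (Q.*-comm (fromℕ (denominator λ')) (invProd λ'))
                                            (invProdGo-*-denominatorFrom 0 0 λ'))) ⟩
    fromℕ (H λ' n) Q.* (fromℕ (denominator λ') Q.* invProd λ')
  ≡⟨ sym (Q.*-assoc (fromℕ (H λ' n)) (fromℕ (denominator λ')) (invProd λ')) ⟩
    fromℕ (H λ' n) Q.* fromℕ (denominator λ') Q.* invProd λ'
  ≡⟨ cong (Q._* invProd λ') (sym (fromℕ-* (H λ' n) (denominator λ'))) ⟩
    fromℕ (H λ' n * denominator λ') Q.* invProd λ'
  ≡⟨ cong (λ t → fromℕ t Q.* invProd λ') (H-*-denominator λ' n) ⟩
    fromℕ (n P′ (size λ' + length λ')) Q.* invProd λ' ∎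

fromℕ-calH : ∀ μ n O → All (_↭ μ) O →
  fromℕ (calH O n) ≡ fromℕ (n P′ (size μ + length μ)) Q.* foldr Q._+_ 0ℚ (map invProd O)
fromℕ-calH μ n [] [] = sym (Q.*-zeroʳ (fromℕ (n P′ (size μ + length μ))))
fromℕ-calH μ n (λ' ∷ O) (λ'↭μ ∷ O↭μ) = begin
    fromℕ (H λ' n + calH O n)
  ≡⟨ fromℕ-+ (H λ' n) (calH O n) ⟩
    fromℕ (H λ' n) Q.+ fromℕ (calH O n)
  ≡⟨ cong₂ Q._+_ (fromℕ-H λ' n) (fromℕ-calH μ n O O↭μ) ⟩
    fromℕ (n P′ (size λ' + length λ')) Q.* invProd λ' Q.+ F Q.* foldr Q._+_ 0ℚ (map invProd O)
  ≡⟨ cong (λ t → fromℕ (n P′ t) Q.* invProd λ' Q.+ F Q.* foldr Q._+_ 0ℚ (map invProd O))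
          (cong₂ _+_ (sum-↭ λ'↭μ) (↭-length λ'↭μ)) ⟩
    F Q.* invProd λ' Q.+ F Q.* foldr Q._+_ 0ℚ (map invProd O)
  ≡⟨ sym (Q.*-distribˡ-+ F (invProd λ') _) ⟩
    F Q.* foldr Q._+_ 0ℚ (map invProd (λ' ∷ O)) ∎
  where
  F = fromℕ (n P′ (size μ + length μ))

mainTheorem7 : (n m : ℕ) (μ : List ℕ) → 0 < n → 0 < m → IsPartition μ m →
    (O : List (List ℕ)) → Unique O → (∀ (λ' : List ℕ) → (λ' ∈ O) ⇔ (λ' ↭ μ)) →
    Q._/_ (+ calH O n) 1
      ≡ Q._/_ (fallingℤ n (size μ Data.Nat.+ length μ)) 1
          Q.* foldr Q._+_ 0ℚ (map invProd O)
-- Only O ⊆ Orb(μ) is needed: the identity holds for every list of rearrangements of μ.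
mainTheorem7 n m μ _ _ _ O _ O≡Orb[μ] = begin
    fromℕ (calH O n)
  ≡⟨ fromℕ-calH μ n O (All.tabulate (λ {λ'} → Equivalence.to (O≡Orb[μ] λ'))) ⟩
    fromℕ (n P′ (size μ + length μ)) Q.* Σinv
  ≡⟨ cong (λ z → z Q./ 1 Q.* Σinv) (sym (fallingℤ≡P′ n (size μ + length μ))) ⟩
    fallingℤ n (size μ + length μ) Q./ 1 Q.* Σinv ∎
  where
  Σinv = foldr Q._+_ 0ℚ (map invProd O)
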